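{- For all $n\ge0$, \[ p_n^2=\delta_{n,0}+p_{n-2}^2+p_{n-3}^2+2\sum_{l=5}^nc_{l-5}p_{n-l}^2 . \]
   Context: The Narayana's cows numbers $c_n$ are defined by $c_n=\delta_{n,0}+c_{n-1}+c_{n-3}$ for $n\ge0$, $c_n=0$ for $n<0$. The Padovan numbers $p_n$ are defined by $p_n=\delta_{n,0}+p_{n-2}+p_{n-3}$ for $n\ge0$, $p_n=0$ for $n<0$. $\delta_{i,j}$ is $1$ if $i=j$ and $0$ otherwise; empty sums are $0$. -}

module Defs where

open import Data.Nat using (ℕ; zero; suc; _+_; _*_; _∸_)
open import Data.Integer using (ℤ; +_; -[1+_])
open import Data.Integer using () renaming (_-_ to _-ℤ_)

δ₀ : ℕ → ℕ
δ₀ zero    = 1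
δ₀ (suc _) = 0

-- Narayana's cows numbers c_n (n ≥ 0): c_n = δ_{n,0} + c_{n-1} + c_{n-3}, with c_n = 0 for n < 0
c : ℕ → ℕ
c 0 = 1
c 1 = c 0
c 2 = c 1
c (suc (suc (suc n))) = c (suc (suc n)) + c n

-- Padovan numbers p_n (n ≥ 0): p_n = δ_{n,0} + p_{n-2} + p_{n-3}, with p_n = 0 for n < 0
p : ℕ → ℕ
p 0 = 1
p 1 = 0
p 2 = p 0
p (suc (suc (suc n))) = p (suc n) + p n

pℤ : ℤ → ℕ
pℤ (+ n)      = p n
pℤ -[1+ _ ]   = 0

cℤ : ℤ → ℕ
cℤ (+ n)      = c n
cℤ -[1+ _ ]   = 0

p[_-_] : ℕ → ℕ → ℕ
p[ n - k ] = pℤ (+ n -ℤ + k)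

c[_-_] : ℕ → ℕ → ℕ
c[ n - k ] = cℤ (+ n -ℤ + k)

sumFromTo : ℕ → ℕ → (ℕ → ℕ) → ℕ
sumFromTo a b f = go (suc b ∸ a)
  where
  go : ℕ → ℕ
  go zero    = 0
  go (suc k) = go k + f (a + k)

{-# OPTIONS --safe #-}
-- Write P m = p (m+3) p (m+2). From p (m+5) = p (m+3) + p (m+2) one gets
-- p (m+5)² = p (m+3)² + p (m+2)² + 2 P m, so it suffices to show that P is the
-- convolution of the cows numbers with the squares of the Padovan numbers. Both
-- sequences satisfy x (m+3) = p (m+3)² + x (m+2) + x m: the convolution because
-- c k = δ k 0 + c (k-1) + c (k-3), and P by expanding with the Padovan recurrence.
-- They agree for m = 0, 1, 2, hence everywhere.
module Submission where

open import Defs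
open import Data.Nat using (ℕ; _+_; _*_; zero; suc; _∸_; _≤_; s≤s)
open import Data.Nat.Properties using (≤-refl; m≤n⇒m≤1+n; +-∸-assoc; n∸n≡0)
open import Data.Integer.Properties using ([+m]-[+n]≡m⊖n; ⊖-≥)
open import Function using (_∘_)
open import Relation.Binary.PropositionalEquality using (_≡_; refl; sym; trans; cong; cong₂; module ≡-Reasoning)
open import Data.Nat.Tactic.RingSolver using (solve-∀)

thirdOrder-unique : (g f h : ℕ → ℕ) →
  (∀ m → f (3 + m) ≡ g m + f (2 + m) + f m) →
  (∀ m → h (3 + m) ≡ g m + h (2 + m) + h m) →
  f 0 ≡ h 0 → f 1 ≡ h 1 → f 2 ≡ h 2 → ∀ m → f m ≡ h m
thirdOrder-unique g f h f-rec h-rec f₀ f₁ f₂ = agree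
  where
  agree : ∀ m → f m ≡ h m
  agree 0 = f₀
  agree 1 = f₁
  agree 2 = f₂
  agree (suc (suc (suc m))) = trans (f-rec m)
    (trans (cong₂ (λ x y → g m + x + y) (agree (suc (suc m))) (agree m)) (sym (h-rec m)))

-- cowConvolution g m = Σ_{k ≤ m} c k * g (m ∸ k), peeling off the term k = m.
cowConvolution : (ℕ → ℕ) → ℕ → ℕ
cowConvolution g zero    = c 0 * g 0
cowConvolution g (suc m) = cowConvolution (g ∘ suc) m + c (suc m) * g 0

cowConvolution-rec : ∀ m (g : ℕ → ℕ) →
  cowConvolution g (3 + m) ≡ g (3 + m) + cowConvolution g (2 + m) + cowConvolution g m
cowConvolution-rec zero g = base (g 0) (g 1) (g 2) (g 3)
  where
  base : ∀ a b d e → 1 * e + 1 * d + 1 * b + 2 * a ≡ e + (1 * d + 1 * b + 1 * a) + 1 * a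
  base = solve-∀
cowConvolution-rec (suc m) g = begin
  cowConvolution (g ∘ suc) (3 + m) + (c (3 + m) + c (1 + m)) * g 0
    ≡⟨ cong (_+ (c (3 + m) + c (1 + m)) * g 0) (cowConvolution-rec m (g ∘ suc)) ⟩
  g (4 + m) + cowConvolution (g ∘ suc) (2 + m) + cowConvolution (g ∘ suc) m
    + (c (3 + m) + c (1 + m)) * g 0
    ≡⟨ regroup (g (4 + m)) (cowConvolution (g ∘ suc) (2 + m)) (cowConvolution (g ∘ suc) m)
               (c (3 + m)) (c (1 + m)) (g 0) ⟩
  g (4 + m) + (cowConvolution (g ∘ suc) (2 + m) + c (3 + m) * g 0)
    + (cowConvolution (g ∘ suc) m + c (1 + m) * g 0) ∎
  where
  open ≡-Reasoning
  regroup : ∀ x y z u v w → x + y + z + (u + v) * w ≡ x + (y + u * w) + (z + v * w)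
  regroup = solve-∀

padovanProduct-rec : ∀ m →
  p (6 + m) * p (5 + m) ≡ p (3 + m) * p (3 + m) + p (5 + m) * p (4 + m) + p (3 + m) * p (2 + m)
padovanProduct-rec m = expand (p (2 + m)) (p (3 + m)) (p (4 + m))
  where
  expand : ∀ a b d → (d + b) * (b + a) ≡ b * b + (b + a) * d + b * a
  expand = solve-∀

cowConvolution-padovanSquares : ∀ m →
  cowConvolution (λ i → p i * p i) m ≡ p (3 + m) * p (2 + m)
cowConvolution-padovanSquares = thirdOrder-unique (λ m → p (3 + m) * p (3 + m))
  (cowConvolution (λ i → p i * p i)) (λ m → p (3 + m) * p (2 + m))
  (λ m → cowConvolution-rec m (λ i → p i * p i)) padovanProduct-rec
  refl refl refl

partialConvolution : (ℕ → ℕ) → ℕ → ℕ → ℕ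
partialConvolution g m zero    = 0
partialConvolution g m (suc K) = partialConvolution g m K + c K * g (m ∸ K)

partialConvolution-suc : ∀ g m K → K ≤ suc m →
  partialConvolution g (suc m) K ≡ partialConvolution (g ∘ suc) m K
partialConvolution-suc g m zero    _         = refl
partialConvolution-suc g m (suc K) (s≤s K≤m) =
  cong₂ (λ x y → x + c K * g y) (partialConvolution-suc g m K (m≤n⇒m≤1+n K≤m)) (+-∸-assoc 1 K≤m)

partialConvolution-complete : ∀ m (g : ℕ → ℕ) →
  partialConvolution g m (suc m) ≡ cowConvolution g m
partialConvolution-complete zero    g = refl
partialConvolution-complete (suc m) g = cong₂ (λ x y → x + c (suc m) * g y)
  (trans (partialConvolution-suc g m (suc m) ≤-refl) (partialConvolution-complete m (g ∘ suc)))
  (n∸n≡0 m)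

p[-]≡p∸ : ∀ {m k} → k ≤ m → p[ m - k ] ≡ p (m ∸ k)
p[-]≡p∸ {m} {k} k≤m = cong pℤ (trans ([+m]-[+n]≡m⊖n m k) (⊖-≥ k≤m))

sumFromTo-partialConvolution : ∀ m K → K ≤ suc m →
  sumFromTo 5 (4 + K) (λ l → c[ l - 5 ] * (p[ 5 + m - l ] * p[ 5 + m - l ]))
    ≡ partialConvolution (λ i → p i * p i) m K
sumFromTo-partialConvolution m zero    _         = refl
sumFromTo-partialConvolution m (suc K) (s≤s K≤m) =
  cong₂ (λ x y → x + c K * (y * y))
    (sumFromTo-partialConvolution m K (m≤n⇒m≤1+n K≤m)) (p[-]≡p∸ (s≤s (s≤s (s≤s (s≤s (s≤s K≤m))))))

mainTheorem14 : ∀ (n : ℕ) →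
    p n * p n
      ≡ δ₀ n + p[ n - 2 ] * p[ n - 2 ] + p[ n - 3 ] * p[ n - 3 ]
        + 2 * sumFromTo 5 n (λ l → c[ l - 5 ] * (p[ n - l ] * p[ n - l ]))
mainTheorem14 0 = refl
mainTheorem14 1 = refl
mainTheorem14 2 = refl
mainTheorem14 3 = refl
mainTheorem14 4 = refl
mainTheorem14 (suc (suc (suc (suc (suc m))))) = begin
  (p (3 + m) + p (2 + m)) * (p (3 + m) + p (2 + m))
    ≡⟨ square-+ (p (3 + m)) (p (2 + m)) ⟩
  p (3 + m) * p (3 + m) + p (2 + m) * p (2 + m) + 2 * (p (3 + m) * p (2 + m))
    ≡⟨ cong (λ x → p (3 + m) * p (3 + m) + p (2 + m) * p (2 + m) + 2 * x) (sym tail) ⟩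
  _ ∎
  where
  open ≡-Reasoning
  square-+ : ∀ a b → (a + b) * (a + b) ≡ a * a + b * b + 2 * (a * b)
  square-+ = solve-∀
  tail : sumFromTo 5 (5 + m) (λ l → c[ l - 5 ] * (p[ 5 + m - l ] * p[ 5 + m - l ]))
           ≡ p (3 + m) * p (2 + m)
  tail = trans (sumFromTo-partialConvolution m (suc m) ≤-refl)
    (trans (partialConvolution-complete m (λ i → p i * p i)) (cowConvolution-padovanSquares m))
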